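{- Every palindromic factor of $\mathbf{x}=f^\omega(0)$ has a unique palindromic extension in $\mathbf{x}$, i.e., for every palindromic factor $w$ of $\mathbf{x}$ there is exactly one letter $a$ such that $awa$ is a factor of $\mathbf{x}$.
   Context: $f(0)=01$, $f(1)=022$, $f(2)=02$ on $\Sigma_3=\{0,1,2\}$; $f^\omega(0)$ is its fixed point beginning with $0$. A palindromic extension of a palindromic factor $w$ is a factor of the form $awb$ ($a,b$ letters) that is a palindrome, i.e., $a=b$. -}

module Defs where

open import Data.Nat using (ℕ; zero; suc; _+_)
open import Data.Fin using (Fin; zero; suc)
open import Data.List using (List; []; _∷_; _++_; concatMap; reverse; length)
open import Data.Product using (∃)
open import Relation.Binary.PropositionalEquality using (_≡_)
open import Function using (_∘_)

Letter : Set
Letter = Fin 3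

pattern l0 = zero
pattern l1 = suc zero
pattern l2 = suc (suc zero)

f : Letter → List Letter
f l0 = l0 ∷ l1 ∷ []
f l1 = l0 ∷ l2 ∷ l2 ∷ []
f l2 = l0 ∷ l2 ∷ []

f* : List Letter → List Letter
f* = concatMap f

fIter : ℕ → List Letter
fIter zero = l0 ∷ []
fIter (suc k) = f* (fIter k)

-- n-th letter of a finite word, with a default (never used below, see x)
nth : List Letter → ℕ → Letter
nth [] _ = l0
nth (a ∷ _) zero = a
nth (_ ∷ w) (suc n) = nth w n

-- The fixed point x = f^ω(0): since f(0) begins with 0 and |f^k(0)| ≥ k+1,
-- f^k(0) is a prefix of x for every k, and x(n) is the n-th letter of f^(n+1)(0).
x : ℕ → Letter
x n = nth (fIter (suc n)) n

factorAt : ℕ → ℕ → List Letter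
factorAt i zero = []
factorAt i (suc n) = x i ∷ factorAt (suc i) n

Factor : List Letter → Set
Factor w = ∃ λ i → factorAt i (length w) ≡ w

Palindrome : List Letter → Set
Palindrome w = reverse w ≡ w

-- The image of every letter begins with 0 and contains no other 0, so the 0s of f*(y) mark the
-- blocks f(c).  Hence a factor w of x containing a 0 desubstitutes uniquely as w = ρ f(u) 0 σ
-- with gaps ρ, σ ∈ {ε, 1, 2, 22}, and the bilateral extensions a w b are exactly the images of
-- the bilateral extensions c u d, where f(c) must end with a ρ and f(d) 0 begin with 0 σ b.
-- Since f(c) 0 is a palindrome for every letter c, w is a palindrome only if ρ = σ and u is a
-- palindrome.  By induction on the length, the extension set of a palindromic factor is
-- therefore obtained from those of the gaps by finitely many image maps; only eight sets arise,
-- and each contains exactly one pair (a , a).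

module Submission where

open import Data.Empty using (⊥-elim)
open import Data.List using (List; _∷_; _++_; []; length; reverse; [_])
open import Data.List.Properties
  using ( ++-monoid; ++-assoc; ++-identityʳ; ++-cancelˡ; concatMap-++; reverse-++; unfold-reverse
        ; length-++; length-++-≤ˡ; length-++-≤ʳ; length-++-sucʳ; ∷-injective; ∷-injectiveˡ; ∷-injectiveʳ )
open import Data.Maybe using (Maybe; just; nothing)
open import Data.Maybe.Relation.Unary.Any using (Any; just; drop-just)
open import Data.Nat using (zero; suc; _+_; _∸_; _≤_; _<_; s≤s; z≤n)
open import Data.Nat.Induction using (<-wellFounded)
open import Data.Nat.Properties
  using ( +-suc; +-comm; +-assoc; +-identityʳ; +-mono-≤; +-monoʳ-≤; suc-injective
        ; ≤-trans; ≤-total; ≤-reflexive; m∸n+n≡m; m+[n∸m]≡n; m≤m+n; n≤1+n; module ≤-Reasoning )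
open import Data.Product using (∃; ∃₂; ∃!; _×_; _,_; proj₁; proj₂; map₁; map₂)
open import Data.Sum using (_⊎_; inj₁; inj₂)
open import Induction.WellFounded using (Acc; acc)
open import Relation.Binary.PropositionalEquality
  using (_≡_; refl; sym; trans; cong; cong₂; subst; module ≡-Reasoning)
open import Relation.Nullary using (¬_)
open import Tactic.MonoidSolver using (solve)

open import Defs

Word : Set
Word = List Letter

Any⇒just : ∀ {A : Set} {P : A → Set} {m} → Any P m → ∃ λ x → m ≡ just x
Any⇒just (just {x} _) = x , refl

++-cancel-length : ∀ {A : Set} (p p′ : List A) {q q′ : List A} →
                   length p ≡ length p′ → p ++ q ≡ p′ ++ q′ → p ≡ p′ × q ≡ q′
++-cancel-length [] [] _ eq = refl , eq
++-cancel-length (a ∷ p) (a′ ∷ p′) len eq with ∷-injective eq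
... | refl , eq′ with ++-cancel-length p p′ (suc-injective len) eq′
... | refl , q≡q′ = refl , q≡q′

++-split : ∀ {A : Set} (p q a b : List A) → p ++ q ≡ a ++ b →
           (∃ λ t → p ≡ a ++ t × b ≡ t ++ q) ⊎ (∃₂ λ z t → a ≡ p ++ z ∷ t × q ≡ z ∷ t ++ b)
++-split [] q [] b eq = inj₁ ([] , refl , sym eq)
++-split [] q (z ∷ a) b eq = inj₂ (z , a , refl , eq)
++-split (c ∷ p) q [] b eq = inj₁ (c ∷ p , refl , sym eq)
++-split (c ∷ p) q (d ∷ a) b eq with ∷-injective eq
... | refl , eq′ with ++-split p q a b eq′
... | inj₁ (t , refl , b≡) = inj₁ (t , refl , b≡)
... | inj₂ (z , t , refl , q≡) = inj₂ (z , t , refl , q≡)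

snoc-view : ∀ {A : Set} (a : A) p → ∃₂ λ p′ a′ → a ∷ p ≡ p′ ++ a′ ∷ []
snoc-view a [] = [] , a , refl
snoc-view a (b ∷ p) with snoc-view b p
... | p′ , a′ , eq = a ∷ p′ , a′ , cong (a ∷_) eq

cons-view : ∀ {A : Set} s (b : A) → ∃₂ λ b′ s′ → s ++ b ∷ [] ≡ b′ ∷ s′
cons-view [] b = b , [] , refl
cons-view (c ∷ s) b = c , s ++ b ∷ [] , refl

f*-++ : ∀ u v → f* (u ++ v) ≡ f* u ++ f* v
f*-++ = concatMap-++ f

blockTail : Letter → Word
blockTail l0 = l1 ∷ []
blockTail l1 = l2 ∷ l2 ∷ []
blockTail l2 = l2 ∷ []

f≡0∷blockTail : ∀ c → f c ≡ l0 ∷ blockTail c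
f≡0∷blockTail l0 = refl
f≡0∷blockTail l1 = refl
f≡0∷blockTail l2 = refl

f*-∷ : ∀ c u → f* (c ∷ u) ≡ l0 ∷ blockTail c ++ f* u
f*-∷ c u = cong (_++ f* u) (f≡0∷blockTail c)

length-f* : ∀ u → length u + length u ≤ length (f* u)
length-f* [] = z≤n
length-f* (c ∷ u) rewrite +-suc (length u) (length u) = grow c
  where
  grow : ∀ c → suc (suc (length u + length u)) ≤ length (f* (c ∷ u))
  grow l0 = s≤s (s≤s (length-f* u))
  grow l1 = s≤s (s≤s (≤-trans (length-f* u) (n≤1+n _)))
  grow l2 = s≤s (s≤s (length-f* u))

fIter-step : ∀ k → ∃ λ t → fIter k ++ t ≡ fIter (suc k)
fIter-step zero = l1 ∷ [] , refl
fIter-step (suc k) with fIter-step k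
... | t , eq = f* t , trans (sym (f*-++ (fIter k) t)) (cong f* eq)

fIter-prefix : ∀ d k → ∃ λ t → fIter k ++ t ≡ fIter (d + k)
fIter-prefix zero k = [] , ++-identityʳ (fIter k)
fIter-prefix (suc d) k with fIter-prefix d k | fIter-step (d + k)
... | t , eq | t′ , eq′ = t ++ t′ , trans (sym (++-assoc (fIter k) t t′)) (trans (cong (_++ t′) eq) eq′)

length-fIter : ∀ k → suc k ≤ length (fIter k)
length-fIter zero = s≤s z≤n
length-fIter (suc k) = ≤-trans (subst (_≤ length G + length G) (+-comm (suc k) 1) bound) (length-f* G)
  where
  G = fIter k
  bound : suc k + 1 ≤ length G + length G
  bound = +-mono-≤ (length-fIter k) (≤-trans (s≤s z≤n) (length-fIter k))

-- Factors of x are the factors of the iterates f^k(0)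

nth-++ˡ : ∀ u t {j} → j < length u → nth (u ++ t) j ≡ nth u j
nth-++ˡ (a ∷ u) t {zero} _ = refl
nth-++ˡ (a ∷ u) t {suc j} (s≤s j<) = nth-++ˡ u t j<

nth-fIter-≤ : ∀ {k m j} → k ≤ m → j < length (fIter k) → nth (fIter k) j ≡ nth (fIter m) j
nth-fIter-≤ {k} {m} {j} k≤m j< with fIter-prefix (m ∸ k) k
... | t , eq = trans (sym (nth-++ˡ (fIter k) t j<)) (cong (λ v → nth v j) (trans eq (cong fIter (m∸n+n≡m k≤m))))

x-fIter : ∀ k {j} → j < length (fIter k) → x j ≡ nth (fIter k) j
x-fIter k {j} j< with ≤-total k (suc j)
... | inj₁ k≤ = sym (nth-fIter-≤ k≤ j<)
... | inj₂ ≥k = nth-fIter-≤ ≥k (≤-trans (n≤1+n _) (length-fIter (suc j)))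

length-factorAt : ∀ i n → length (factorAt i n) ≡ n
length-factorAt i zero = refl
length-factorAt i (suc n) = cong suc (length-factorAt (suc i) n)

factorAt-++ : ∀ i m n → factorAt i (m + n) ≡ factorAt i m ++ factorAt (i + m) n
factorAt-++ i zero n rewrite +-identityʳ i = refl
factorAt-++ i (suc m) n rewrite +-suc i m = cong (x i ∷_) (factorAt-++ (suc i) m n)

factorAt-nth : ∀ u i → (∀ j → j < length u → x (j + i) ≡ nth u j) → factorAt i (length u) ≡ u
factorAt-nth [] i _ = refl
factorAt-nth (a ∷ u) i h = cong₂ _∷_ (h 0 (s≤s z≤n)) (factorAt-nth u (suc i) h′)
  where
  h′ : ∀ j → j < length u → x (j + suc i) ≡ nth u j
  h′ j j< rewrite +-suc j i = h (suc j) (s≤s j<)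

fIter-prefix-of-x : ∀ k → factorAt 0 (length (fIter k)) ≡ fIter k
fIter-prefix-of-x k = factorAt-nth (fIter k) 0 λ j j< → subst (λ n → x n ≡ nth (fIter k) j) (sym (+-identityʳ j)) (x-fIter k j<)

fIter-slice : ∀ k i n → i + n ≤ length (fIter k) →
              factorAt 0 i ++ factorAt i n ++ factorAt (i + n) (length (fIter k) ∸ (i + n)) ≡ fIter k
fIter-slice k i n le = begin
  factorAt 0 i ++ factorAt i n ++ factorAt (i + n) r ≡⟨ cong (factorAt 0 i ++_) (sym (factorAt-++ i n r)) ⟩
  factorAt 0 i ++ factorAt i (n + r)                 ≡⟨ sym (factorAt-++ 0 i (n + r)) ⟩
  factorAt 0 (i + (n + r))                           ≡⟨ cong (factorAt 0) (sym (+-assoc i n r)) ⟩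
  factorAt 0 (i + n + r)                             ≡⟨ cong (factorAt 0) (m+[n∸m]≡n le) ⟩
  factorAt 0 (length (fIter k))                      ≡⟨ fIter-prefix-of-x k ⟩
  fIter k                                            ∎
  where
  open ≡-Reasoning
  r = length (fIter k) ∸ (i + n)

Infix : Word → Word → Set
Infix w v = ∃₂ λ p s → p ++ w ++ s ≡ v

Factor′ : Word → Set
Factor′ w = ∃ λ k → Infix w (fIter k)

Factor⇒Factor′ : ∀ {w} → Factor w → Factor′ w
Factor⇒Factor′ {w} (i , eq) = k , factorAt 0 i , rest , subst (λ v → factorAt 0 i ++ v ++ rest ≡ fIter k) eq slice
  where
  k = i + length w
  rest = factorAt k (length (fIter k) ∸ k)
  slice : factorAt 0 i ++ factorAt i (length w) ++ rest ≡ fIter k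
  slice = fIter-slice k i (length w) (≤-trans (n≤1+n k) (length-fIter k))

Factor′⇒Factor : ∀ {w} → Factor′ w → Factor w
Factor′⇒Factor {w} (k , p , s , eq) = length p , proj₁ (++-cancel-length (factorAt i n) w (length-factorAt i n) middle)
  where
  i = length p
  n = length w
  length-occurrence : i + (n + length s) ≡ length (fIter k)
  length-occurrence = trans (cong (i +_) (sym (length-++ w))) (trans (sym (length-++ p)) (cong length eq))
  le : i + n ≤ length (fIter k)
  le = ≤-trans (+-monoʳ-≤ i (m≤m+n n (length s))) (≤-reflexive length-occurrence)
  middle : factorAt i n ++ factorAt (i + n) (length (fIter k) ∸ (i + n)) ≡ w ++ s
  middle = proj₂ (++-cancel-length (factorAt 0 i) p (length-factorAt 0 i) (trans (fIter-slice k i n le) (sym eq)))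

Infix-trans : ∀ {u v w} → Infix u v → Infix v w → Infix u w
Infix-trans {u} (p , s , refl) (p′ , s′ , refl) = p′ ++ p , s ++ s′ , reassoc p′ p u s s′
  where
  reassoc : ∀ (p′ p u s s′ : Word) → (p′ ++ p) ++ u ++ (s ++ s′) ≡ p′ ++ (p ++ u ++ s) ++ s′
  reassoc p′ p u s s′ = solve (++-monoid Letter)

Infix-prefix : ∀ u v → Infix u (u ++ v)
Infix-prefix u v = [] , v , refl

Infix-suffix : ∀ u v → Infix v (u ++ v)
Infix-suffix u v = u , [] , cong (u ++_) (++-identityʳ v)

Infix-fIter-suc : ∀ {w k} → Infix w (fIter k) → Infix w (fIter (suc k))
Infix-fIter-suc {k = k} occ with fIter-step k
... | t , eq = Infix-trans occ (subst (Infix (fIter k)) eq (Infix-prefix (fIter k) t))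

Factor′-prefix : ∀ u {v} → Factor′ (u ++ v) → Factor′ u
Factor′-prefix u {v} (k , occ) = k , Infix-trans (Infix-prefix u v) occ

Factor′-suffix : ∀ u {v} → Factor′ (u ++ v) → Factor′ v
Factor′-suffix u {v} (k , occ) = k , Infix-trans (Infix-suffix u v) occ

Infix-f* : ∀ {u v} → Infix u v → Infix (f* u) (f* v)
Infix-f* {u} (p , s , refl) = f* p , f* s , (begin
  f* p ++ f* u ++ f* s  ≡⟨ cong (f* p ++_) (sym (f*-++ u s)) ⟩
  f* p ++ f* (u ++ s)   ≡⟨ sym (f*-++ p (u ++ s)) ⟩
  f* (p ++ u ++ s)      ∎)
  where open ≡-Reasoning

Factor′-f* : ∀ {v} → Factor′ v → Factor′ (f* v)
Factor′-f* (k , occ) = suc k , Infix-f* occ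

Extension : Word → Letter → Letter → Set
Extension w a b = Factor′ (a ∷ w ++ b ∷ [])

Extension⇒Factor′ : ∀ {w a b} → Extension w a b → Factor′ w
Extension⇒Factor′ {w} {a} {b} e = Factor′-prefix w (Factor′-suffix (a ∷ []) e)

f-last : ∀ a → ∃₂ λ i a′ → f a ≡ i ++ a′ ∷ []
f-last l0 = l0 ∷ [] , l1 , refl
f-last l1 = l0 ∷ l2 ∷ [] , l2 , refl
f-last l2 = l0 ∷ [] , l2 , refl

fIter-interior : ∀ k → ∃₂ λ a b → Infix (a ∷ fIter k ++ b ∷ []) (fIter (2 + k))
fIter-interior zero = l1 , l2 , l0 ∷ [] , l2 ∷ [] , refl
fIter-interior (suc k) with fIter-interior k
... | a , b , occ with f-last a
... | i , a′ , fa≡ = a′ , l0 , Infix-trans inner (Infix-f* occ)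
  where
  G = fIter k
  image : f* (a ∷ G ++ b ∷ []) ≡ (i ++ [ a′ ]) ++ f* G ++ ([ l0 ] ++ blockTail b) ++ []
  image = trans (cong (f a ++_) (f*-++ G (b ∷ []))) (cong₂ (λ u v → u ++ f* G ++ v ++ []) fa≡ (f≡0∷blockTail b))
  inner : Infix (a′ ∷ f* G ++ l0 ∷ []) (f* (a ∷ G ++ b ∷ []))
  inner = i , blockTail b ++ [] , trans (reassoc i [ a′ ] (f* G) [ l0 ] (blockTail b)) (sym image)
    where
    -- The monoid solver sees a ∷ w as an atom, so letters are passed to it as words [ a ].
    reassoc : ∀ (i a g z t : Word) → i ++ (a ++ g ++ z) ++ t ++ [] ≡ (i ++ a) ++ g ++ (z ++ t) ++ []
    reassoc i a g z t = solve (++-monoid Letter)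

Factor′-bi-extension : ∀ {w} → Factor′ w → ∃₂ λ a b → Extension w a b
Factor′-bi-extension {w} (k , p , s , eq) with fIter-interior k
... | a , b , occ with snoc-view a p | cons-view s b
... | p′ , a′ , a∷p≡ | b′ , s′ , s∷ʳb≡ =
  a′ , b′ , 2 + k , Infix-trans (p′ , s′ , sym around) (subst (λ v → Infix (a ∷ v ++ b ∷ []) _) (sym eq) occ)
  where
  reassoc₁ : ∀ (a p w s b : Word) → a ++ (p ++ w ++ s) ++ b ≡ (a ++ p) ++ w ++ (s ++ b)
  reassoc₁ a p w s b = solve (++-monoid Letter)
  reassoc₂ : ∀ (p a w b s : Word) → (p ++ a) ++ w ++ (b ++ s) ≡ p ++ (a ++ w ++ b) ++ s
  reassoc₂ p a w b s = solve (++-monoid Letter)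
  around : a ∷ (p ++ w ++ s) ++ b ∷ [] ≡ p′ ++ (a′ ∷ w ++ b′ ∷ []) ++ s′
  around = trans (reassoc₁ [ a ] p w s [ b ])
          (trans (cong₂ (λ u v → u ++ w ++ v) a∷p≡ s∷ʳb≡) (reassoc₂ p′ [ a′ ] w [ b′ ] s′))

-- The 0s of an image f*(y) mark the blocks f(c)

data ZeroFree : Word → Set where
  []  : ZeroFree []
  1∷_ : ∀ {w} → ZeroFree w → ZeroFree (l1 ∷ w)
  2∷_ : ∀ {w} → ZeroFree w → ZeroFree (l2 ∷ w)

ZeroFree-∌0 : ∀ u {v} → ¬ ZeroFree (u ++ l0 ∷ v)
ZeroFree-∌0 [] ()
ZeroFree-∌0 (_ ∷ u) (1∷ z) = ZeroFree-∌0 u z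
ZeroFree-∌0 (_ ∷ u) (2∷ z) = ZeroFree-∌0 u z

blockTail-zero-free : ∀ c → ZeroFree (blockTail c)
blockTail-zero-free l0 = 1∷ []
blockTail-zero-free l1 = 2∷ 2∷ []
blockTail-zero-free l2 = 2∷ []

first-zero : ∀ w → ZeroFree w ⊎ ∃₂ λ r w₁ → ZeroFree r × w ≡ r ++ l0 ∷ w₁
first-zero [] = inj₁ []
first-zero (l0 ∷ w) = inj₂ ([] , w , [] , refl)
first-zero (l1 ∷ w) with first-zero w
... | inj₁ z = inj₁ (1∷ z)
... | inj₂ (r , w₁ , z , refl) = inj₂ (l1 ∷ r , w₁ , 1∷ z , refl)
first-zero (l2 ∷ w) with first-zero w
... | inj₁ z = inj₁ (2∷ z)
... | inj₂ (r , w₁ , z , refl) = inj₂ (l2 ∷ r , w₁ , 2∷ z , refl)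

last-zero : ∀ w → ZeroFree w ⊎ ∃₂ λ m σ → ZeroFree σ × w ≡ m ++ l0 ∷ σ
last-zero [] = inj₁ []
last-zero (a ∷ w) with last-zero w
... | inj₂ (m , σ , z , refl) = inj₂ (a ∷ m , σ , z , refl)
last-zero (l0 ∷ w) | inj₁ z = inj₂ ([] , w , z , refl)
last-zero (l1 ∷ w) | inj₁ z = inj₁ (1∷ z)
last-zero (l2 ∷ w) | inj₁ z = inj₁ (2∷ z)

f*-head : ∀ y {b s} → b ∷ s ≡ f* y → b ≡ l0
f*-head (c ∷ y) eq = ∷-injectiveˡ (trans eq (f*-∷ c y))

data Gap : Word → Set where
  ε    : Gap []
  ⟨1⟩  : Gap (l1 ∷ [])
  ⟨2⟩  : Gap (l2 ∷ [])
  ⟨22⟩ : Gap (l2 ∷ l2 ∷ [])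

Gap⇒ZeroFree : ∀ {ρ} → Gap ρ → ZeroFree ρ
Gap⇒ZeroFree ε = []
Gap⇒ZeroFree ⟨1⟩ = 1∷ []
Gap⇒ZeroFree ⟨2⟩ = 2∷ []
Gap⇒ZeroFree ⟨22⟩ = 2∷ 2∷ []

Gap⇒Palindrome : ∀ {ρ} → Gap ρ → Palindrome ρ
Gap⇒Palindrome ε = refl
Gap⇒Palindrome ⟨1⟩ = refl
Gap⇒Palindrome ⟨2⟩ = refl
Gap⇒Palindrome ⟨22⟩ = refl

-- Ends ρ c a : the block f c ends with a ∷ ρ.  As f c ++ [ l0 ] is a palindrome,
-- equivalently l0 ∷ ρ ++ [ a ] is a prefix of f c ++ [ l0 ] (see Ends⇒prefix).
data Ends : Word → Letter → Letter → Set where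
  0▹1   : Ends [] l0 l1
  0▹01  : Ends (l1 ∷ []) l0 l0
  1▹2   : Ends [] l1 l2
  1▹22  : Ends (l2 ∷ []) l1 l2
  1▹022 : Ends (l2 ∷ l2 ∷ []) l1 l0
  2▹2   : Ends [] l2 l2
  2▹02  : Ends (l2 ∷ []) l2 l0

Ends⇒Gap : ∀ {ρ c a} → Ends ρ c a → Gap ρ
Ends⇒Gap 0▹1 = ε
Ends⇒Gap 0▹01 = ⟨1⟩
Ends⇒Gap 1▹2 = ε
Ends⇒Gap 1▹22 = ⟨2⟩
Ends⇒Gap 1▹022 = ⟨22⟩
Ends⇒Gap 2▹2 = ε
Ends⇒Gap 2▹02 = ⟨2⟩

Ends⇒suffix : ∀ {ρ c a} → Ends ρ c a → ∃ λ t → f c ≡ t ++ a ∷ ρ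
Ends⇒suffix 0▹1 = l0 ∷ [] , refl
Ends⇒suffix 0▹01 = [] , refl
Ends⇒suffix 1▹2 = l0 ∷ l2 ∷ [] , refl
Ends⇒suffix 1▹22 = l0 ∷ [] , refl
Ends⇒suffix 1▹022 = [] , refl
Ends⇒suffix 2▹2 = l0 ∷ [] , refl
Ends⇒suffix 2▹02 = [] , refl

suffix⇒Ends : ∀ c p {a ρ} → f c ≡ p ++ a ∷ ρ → Ends ρ c a
suffix⇒Ends l0 [] refl = 0▹01
suffix⇒Ends l0 (_ ∷ []) refl = 0▹1
suffix⇒Ends l0 (_ ∷ _ ∷ []) ()
suffix⇒Ends l0 (_ ∷ _ ∷ _ ∷ _) ()
suffix⇒Ends l1 [] refl = 1▹022
suffix⇒Ends l1 (_ ∷ []) refl = 1▹22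
suffix⇒Ends l1 (_ ∷ _ ∷ []) refl = 1▹2
suffix⇒Ends l1 (_ ∷ _ ∷ _ ∷ []) ()
suffix⇒Ends l1 (_ ∷ _ ∷ _ ∷ _ ∷ _) ()
suffix⇒Ends l2 [] refl = 2▹02
suffix⇒Ends l2 (_ ∷ []) refl = 2▹2
suffix⇒Ends l2 (_ ∷ _ ∷ []) ()
suffix⇒Ends l2 (_ ∷ _ ∷ _ ∷ _) ()

Ends⇒prefix : ∀ {σ d b} → Ends σ d b → ∀ t → ∃ λ t′ → f d ++ l0 ∷ t ≡ l0 ∷ σ ++ b ∷ t′
Ends⇒prefix 0▹1 t = l0 ∷ t , refl
Ends⇒prefix 0▹01 t = t , refl
Ends⇒prefix 1▹2 t = l2 ∷ l0 ∷ t , refl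
Ends⇒prefix 1▹22 t = l0 ∷ t , refl
Ends⇒prefix 1▹022 t = t , refl
Ends⇒prefix 2▹2 t = l0 ∷ t , refl
Ends⇒prefix 2▹02 t = t , refl

Ends-blockTail : ∀ d → Ends (blockTail d) d l0
Ends-blockTail l0 = 0▹01
Ends-blockTail l1 = 1▹022
Ends-blockTail l2 = 2▹02

blockTail-prefix⇒Ends : ∀ d σ {b t} → blockTail d ≡ σ ++ b ∷ t → Ends σ d b
blockTail-prefix⇒Ends l0 [] refl = 0▹1
blockTail-prefix⇒Ends l0 (_ ∷ []) ()
blockTail-prefix⇒Ends l0 (_ ∷ _ ∷ _) ()
blockTail-prefix⇒Ends l1 [] refl = 1▹2
blockTail-prefix⇒Ends l1 (_ ∷ []) refl = 1▹22
blockTail-prefix⇒Ends l1 (_ ∷ _ ∷ []) ()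
blockTail-prefix⇒Ends l1 (_ ∷ _ ∷ _ ∷ _) ()
blockTail-prefix⇒Ends l2 [] refl = 2▹2
blockTail-prefix⇒Ends l2 (_ ∷ []) ()
blockTail-prefix⇒Ends l2 (_ ∷ _ ∷ _) ()

f*-cut-at-0 : ∀ y p {q} → p ++ l0 ∷ q ≡ f* y → ∃₂ λ y₁ y₂ → y ≡ y₁ ++ y₂ × p ≡ f* y₁ × l0 ∷ q ≡ f* y₂
f*-cut-at-0 y [] eq = [] , y , refl , refl , eq
f*-cut-at-0 [] (_ ∷ _) ()
f*-cut-at-0 (c ∷ y) (_ ∷ p) {q} eq with ∷-injective (trans eq (f*-∷ c y))
... | refl , eq′ with ++-split p (l0 ∷ q) (blockTail c) (f* y) eq′
... | inj₂ (_ , t , tail≡ , refl) = ⊥-elim (ZeroFree-∌0 p (subst ZeroFree tail≡ (blockTail-zero-free c)))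
... | inj₁ (t , refl , eq″) with f*-cut-at-0 y t (sym eq″)
... | y₁ , y₂ , refl , refl , eq‴ = c ∷ y₁ , y₂ , refl , sym (f*-∷ c y₁) , eq‴

ZeroFree-f* : ∀ t y → ZeroFree (t ++ f* y) → y ≡ []
ZeroFree-f* t [] _ = refl
ZeroFree-f* t (d ∷ y) z = ⊥-elim (ZeroFree-∌0 t (subst (λ v → ZeroFree (t ++ v)) (f*-∷ d y) z))

f*-last-block : ∀ y p {a ρ} → ZeroFree ρ → p ++ a ∷ ρ ≡ f* y → ∃₂ λ y₁ c → y ≡ y₁ ++ c ∷ [] × Ends ρ c a
f*-last-block [] [] _ ()
f*-last-block [] (_ ∷ _) _ ()
f*-last-block (c ∷ y) p {a} {ρ} zρ eq with ++-split p (a ∷ ρ) (f c) (f* y) eq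
... | inj₁ (t , refl , eq′) with f*-last-block y t zρ (sym eq′)
...   | y₁ , c′ , y≡ , e = c ∷ y₁ , c′ , cong (c ∷_) y≡ , e
f*-last-block (c ∷ y) p zρ eq | inj₂ (_ , t , fc≡ , refl) with ZeroFree-f* t y zρ
...   | refl = [] , c , refl , subst (λ ρ → Ends ρ c _) (sym (++-identityʳ t)) (suffix⇒Ends c p fc≡)

f*-first-block : ∀ y {σ b s} → ZeroFree σ → l0 ∷ σ ++ b ∷ s ≡ f* y → ∃₂ λ d y′ → y ≡ d ∷ y′ × Ends σ d b
f*-first-block (d ∷ y) {σ} {b} {s} zσ eq
  with ++-split σ (b ∷ s) (blockTail d) (f* y) (∷-injectiveʳ (trans eq (f*-∷ d y)))
... | inj₂ (_ , t , tail≡ , refl) = d , y , refl , blockTail-prefix⇒Ends d σ tail≡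
... | inj₁ ([] , σ≡ , b∷s≡) with f*-head y (sym b∷s≡)
...   | refl = d , y , refl , subst (λ σ → Ends σ d l0) (sym (trans σ≡ (++-identityʳ _))) (Ends-blockTail d)
f*-first-block (d ∷ y) zσ eq | inj₁ (z ∷ t , refl , z∷≡) with f*-head y (sym z∷≡)
...   | refl = ⊥-elim (ZeroFree-∌0 (blockTail d) zσ)

f*-∌00 : ∀ y {s} → ¬ (l0 ∷ l0 ∷ s ≡ f* y)
f*-∌00 (l0 ∷ y) ()
f*-∌00 (l1 ∷ y) ()
f*-∌00 (l2 ∷ y) ()

00-not-factor : ¬ Factor′ (l0 ∷ l0 ∷ [])
00-not-factor (k , occ) with Infix-fIter-suc {k = k} occ
... | p , s , eq with f*-cut-at-0 (fIter k) p eq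
... | _ , y₂ , _ , _ , eq′ = f*-∌00 y₂ eq′

zero-free-prefix : ∀ {w s} v y → ZeroFree w → w ++ s ≡ v ++ f* y → ∃ λ t → v ≡ w ++ t
zero-free-prefix {[]} v y _ _ = v , refl
zero-free-prefix {x ∷ w} [] y zw eq = ⊥-elim (ZeroFree-∌0 [] (subst (λ x → ZeroFree (x ∷ w)) (f*-head y eq) zw))
zero-free-prefix {x ∷ w} (_ ∷ v) y zw eq with ∷-injective eq | zw
... | refl , eq′ | 1∷ zw′ = map₂ (cong (x ∷_)) (zero-free-prefix v y zw′ eq′)
... | refl , eq′ | 2∷ zw′ = map₂ (cong (x ∷_)) (zero-free-prefix v y zw′ eq′)

zero-free-infix-of-f* : ∀ y p {w s} → ZeroFree w → p ++ w ++ s ≡ f* y → ∃ λ c → Infix w (blockTail c)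
zero-free-infix-of-f* y p {[]} _ _ = l0 , [] , _ , refl
zero-free-infix-of-f* [] [] {_ ∷ _} _ ()
zero-free-infix-of-f* [] (_ ∷ _) {_ ∷ _} _ ()
zero-free-infix-of-f* (c ∷ y) [] {x ∷ w} zw eq =
  ⊥-elim (ZeroFree-∌0 [] (subst (λ x → ZeroFree (x ∷ w)) (∷-injectiveˡ (trans eq (f*-∷ c y))) zw))
zero-free-infix-of-f* (c ∷ y) (_ ∷ p) {w} {s} zw eq
  with ++-split p (w ++ s) (blockTail c) (f* y) (∷-injectiveʳ (trans eq (f*-∷ c y)))
... | inj₁ (t , refl , eq′) = zero-free-infix-of-f* y t zw (sym eq′)
... | inj₂ (z , t , tail≡ , eq′) with zero-free-prefix (z ∷ t) y zw eq′
... | t′ , z∷t≡ = c , p , t′ , sym (trans tail≡ (cong (p ++_) z∷t≡))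

blockTail-infix⇒Gap : ∀ c {w} → Infix w (blockTail c) → Gap w
blockTail-infix⇒Gap c {[]} _ = ε
blockTail-infix⇒Gap l0 {_ ∷ []} ([] , _ , refl) = ⟨1⟩
blockTail-infix⇒Gap l0 {_ ∷ _ ∷ _} ([] , _ , ())
blockTail-infix⇒Gap l0 {_ ∷ _} (_ ∷ [] , _ , ())
blockTail-infix⇒Gap l0 (_ ∷ _ ∷ _ , _ , ())
blockTail-infix⇒Gap l1 {_ ∷ []} ([] , _ , refl) = ⟨2⟩
blockTail-infix⇒Gap l1 {_ ∷ _ ∷ []} ([] , _ , refl) = ⟨22⟩
blockTail-infix⇒Gap l1 {_ ∷ _ ∷ _ ∷ _} ([] , _ , ())
blockTail-infix⇒Gap l1 {_ ∷ []} (_ ∷ [] , _ , refl) = ⟨2⟩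
blockTail-infix⇒Gap l1 {_ ∷ _ ∷ _} (_ ∷ [] , _ , ())
blockTail-infix⇒Gap l1 {_ ∷ _} (_ ∷ _ ∷ [] , _ , ())
blockTail-infix⇒Gap l1 (_ ∷ _ ∷ _ ∷ _ , _ , ())
blockTail-infix⇒Gap l2 {_ ∷ []} ([] , _ , refl) = ⟨2⟩
blockTail-infix⇒Gap l2 {_ ∷ _ ∷ _} ([] , _ , ())
blockTail-infix⇒Gap l2 {_ ∷ _} (_ ∷ [] , _ , ())
blockTail-infix⇒Gap l2 (_ ∷ _ ∷ _ , _ , ())

zero-free-factor⇒Gap : ∀ {w} → Factor′ w → ZeroFree w → Gap w
zero-free-factor⇒Gap (k , occ) zw with Infix-fIter-suc {k = k} occ
... | p , s , eq with zero-free-infix-of-f* (fIter k) p zw eq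
... | c , inf = blockTail-infix⇒Gap c inf

-- Desubstitution

-- ρ f(u) 0 σ: the image of u, closed by the 0 that opens the next block, between two gaps.
⟨_∣_∣_⟩ : Word → Word → Word → Word
⟨ ρ ∣ u ∣ σ ⟩ = ρ ++ f* u ++ l0 ∷ σ

record Desubstitution (w : Word) (a b : Letter) : Set where
  constructor desubstitution
  field
    ρ u σ : Word
    c d   : Letter
    w≡    : w ≡ ⟨ ρ ∣ u ∣ σ ⟩
    inner : Extension u c d
    left  : Ends ρ c a
    right : Ends σ d b

-- Cut an occurrence inside f*(f^k(0)) at the first 0 of w and at its last 0:
-- both are block boundaries.
desubstitute : ∀ {r w₁ a b} → ZeroFree r → Extension (r ++ l0 ∷ w₁) a b → Desubstitution (r ++ l0 ∷ w₁) a b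
desubstitute {r} {w₁} {a} {b} zr (k , occ) = parse (Infix-fIter-suc {k = k} occ)
  where
  reassoc₁ : ∀ (p a r z w b s : Word) → (p ++ a ++ r) ++ z ++ (w ++ b ++ s) ≡ p ++ (a ++ (r ++ z ++ w) ++ b) ++ s
  reassoc₁ p a r z w b s = solve (++-monoid Letter)
  reassoc₂ : ∀ (m z σ b s : Word) → m ++ z ++ (σ ++ b ++ s) ≡ (m ++ z ++ σ) ++ b ++ s
  reassoc₂ m z σ b s = solve (++-monoid Letter)
  reassoc₃ : ∀ (y₀ c u d y₄ : Word) → (y₀ ++ c) ++ u ++ d ++ y₄ ≡ y₀ ++ (c ++ u ++ d) ++ y₄
  reassoc₃ y₀ c u d y₄ = solve (++-monoid Letter)

  parse : Infix (a ∷ (r ++ l0 ∷ w₁) ++ b ∷ []) (f* (fIter k)) → Desubstitution (r ++ l0 ∷ w₁) a b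
  parse (p , s , eq) with f*-cut-at-0 (fIter k) (p ++ a ∷ r) (trans (reassoc₁ p [ a ] r [ l0 ] w₁ [ b ] s) eq)
  ... | y₁ , y₂ , y≡ , left≡ , right≡ with f*-last-block y₁ p zr left≡ | last-zero (l0 ∷ w₁)
  ... | _ | inj₁ ()
  ... | y₀ , c , y₁≡ , l | inj₂ (m , σ , zσ , w₁≡)
    with f*-cut-at-0 y₂ m (trans (reassoc₂ m [ l0 ] σ [ b ] s) (trans (cong (_++ b ∷ s) (sym w₁≡)) right≡))
  ... | u , y₃ , y₂≡ , m≡ , eq₃ with f*-first-block y₃ zσ eq₃
  ... | d , y₄ , y₃≡ , r′ =
    desubstitution r u σ c d (cong (r ++_) (trans w₁≡ (cong (_++ l0 ∷ σ) m≡))) (k , y₀ , y₄ , sym around) l r′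
    where
    around : fIter k ≡ y₀ ++ (c ∷ u ++ d ∷ []) ++ y₄
    around = begin
      fIter k                            ≡⟨ y≡ ⟩
      y₁ ++ y₂                           ≡⟨ cong₂ _++_ y₁≡ (trans y₂≡ (cong (u ++_) y₃≡)) ⟩
      (y₀ ++ [ c ]) ++ u ++ [ d ] ++ y₄   ≡⟨ reassoc₃ y₀ [ c ] u [ d ] y₄ ⟩
      y₀ ++ (c ∷ u ++ d ∷ []) ++ y₄      ∎
      where open ≡-Reasoning

lift-extension : ∀ {ρ σ u c d a b} → Extension u c d → Ends ρ c a → Ends σ d b → Extension ⟨ ρ ∣ u ∣ σ ⟩ a b
lift-extension {ρ} {σ} {u} {c} {d} {a} {b} ext l r with Factor′-bi-extension ext | Ends⇒suffix l
... | _ , e , ext′ | t , fc≡ with Ends⇒prefix r (blockTail e ++ [])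
... | t′ , fde≡ with Factor′-f* (Factor′-suffix [ _ ] ext′)
... | k , occ = k , Infix-trans (t , t′ , sym image) occ
  where
  reassoc : ∀ (t a ρ g z σ b t′ : Word) → (t ++ a ++ ρ) ++ g ++ (z ++ σ ++ b ++ t′) ≡ t ++ (a ++ (ρ ++ g ++ z ++ σ) ++ b) ++ t′
  reassoc t a ρ g z σ b t′ = solve (++-monoid Letter)
  image : f* ((c ∷ u ++ d ∷ []) ++ e ∷ []) ≡ t ++ (a ∷ ⟨ ρ ∣ u ∣ σ ⟩ ++ b ∷ []) ++ t′
  image = begin
    f c ++ f* ((u ++ d ∷ []) ++ e ∷ [])          ≡⟨ cong (λ v → f c ++ f* v) (++-assoc u [ d ] [ e ]) ⟩
    f c ++ f* (u ++ d ∷ e ∷ [])                  ≡⟨ cong (f c ++_) (f*-++ u (d ∷ e ∷ [])) ⟩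
    f c ++ f* u ++ f d ++ f e ++ []              ≡⟨ cong₂ (λ v v′ → v ++ f* u ++ v′) fc≡
                                                     (trans (cong (λ v → f d ++ v ++ []) (f≡0∷blockTail e)) fde≡) ⟩
    (t ++ a ∷ ρ) ++ f* u ++ l0 ∷ σ ++ b ∷ t′     ≡⟨ reassoc t [ a ] ρ (f* u) [ l0 ] σ [ b ] t′ ⟩
    t ++ (a ∷ ⟨ ρ ∣ u ∣ σ ⟩ ++ b ∷ []) ++ t′     ∎
    where open ≡-Reasoning

zero-free-prefix-unique : ∀ {ρ ρ′ v v′} → ZeroFree ρ → ZeroFree ρ′ → ρ ++ l0 ∷ v ≡ ρ′ ++ l0 ∷ v′ → ρ ≡ ρ′ × v ≡ v′
zero-free-prefix-unique [] [] eq = refl , ∷-injectiveʳ eq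
zero-free-prefix-unique [] (1∷ _) ()
zero-free-prefix-unique [] (2∷ _) ()
zero-free-prefix-unique (1∷ _) [] ()
zero-free-prefix-unique (2∷ _) [] ()
zero-free-prefix-unique (1∷ _) (2∷ _) ()
zero-free-prefix-unique (2∷ _) (1∷ _) ()
zero-free-prefix-unique (1∷ z) (1∷ z′) eq = map₁ (cong (l1 ∷_)) (zero-free-prefix-unique z z′ (∷-injectiveʳ eq))
zero-free-prefix-unique (2∷ z) (2∷ z′) eq = map₁ (cong (l2 ∷_)) (zero-free-prefix-unique z z′ (∷-injectiveʳ eq))

block-cancel : ∀ c d {X Y} → f c ++ l0 ∷ X ≡ f d ++ l0 ∷ Y → c ≡ d × X ≡ Y
block-cancel l0 l0 refl = refl , refl
block-cancel l1 l1 refl = refl , refl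
block-cancel l2 l2 refl = refl , refl
block-cancel l0 l1 ()
block-cancel l0 l2 ()
block-cancel l1 l0 ()
block-cancel l1 l2 ()
block-cancel l2 l0 ()
block-cancel l2 l1 ()

f*-++-0 : ∀ u t → ∃ λ t′ → f* u ++ l0 ∷ t ≡ l0 ∷ t′
f*-++-0 [] t = t , refl
f*-++-0 (c ∷ u) t = blockTail c ++ f* u ++ l0 ∷ t , (begin
  (f c ++ f* u) ++ l0 ∷ t           ≡⟨ ++-assoc (f c) (f* u) (l0 ∷ t) ⟩
  f c ++ f* u ++ l0 ∷ t             ≡⟨ cong (_++ f* u ++ l0 ∷ t) (f≡0∷blockTail c) ⟩
  l0 ∷ blockTail c ++ f* u ++ l0 ∷ t ∎)
  where open ≡-Reasoning

ZeroFree-∌f*0 : ∀ t u {σ} → ¬ ZeroFree (t ++ f* u ++ l0 ∷ σ)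
ZeroFree-∌f*0 t u {σ} z with f*-++-0 u σ
... | t′ , eq = ZeroFree-∌0 t (subst (λ v → ZeroFree (t ++ v)) eq z)

f*-0-cancel : ∀ u u′ {σ σ′} → ZeroFree σ → ZeroFree σ′ → f* u ++ l0 ∷ σ ≡ f* u′ ++ l0 ∷ σ′ → u ≡ u′ × σ ≡ σ′
f*-0-cancel [] [] _ _ eq = refl , ∷-injectiveʳ eq
f*-0-cancel [] (d ∷ u′) {σ′ = σ′} zσ _ eq =
  ⊥-elim (ZeroFree-∌f*0 (blockTail d) u′ (subst ZeroFree (∷-injectiveʳ (trans eq (proj₂ (f*-++-0 (d ∷ u′) σ′)))) zσ))
f*-0-cancel (c ∷ u) [] {σ} _ zσ′ eq =
  ⊥-elim (ZeroFree-∌f*0 (blockTail c) u (subst ZeroFree (∷-injectiveʳ (trans (sym eq) (proj₂ (f*-++-0 (c ∷ u) σ)))) zσ′))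
f*-0-cancel (c ∷ u) (d ∷ u′) {σ} {σ′} zσ zσ′ eq with f*-++-0 u σ | f*-++-0 u′ σ′
... | t , t≡ | t′ , t′≡ with block-cancel c d (begin
      f c ++ l0 ∷ t            ≡⟨ cong (f c ++_) (sym t≡) ⟩
      f c ++ f* u ++ l0 ∷ σ    ≡⟨ sym (++-assoc (f c) (f* u) _) ⟩
      f* (c ∷ u) ++ l0 ∷ σ     ≡⟨ eq ⟩
      f* (d ∷ u′) ++ l0 ∷ σ′   ≡⟨ ++-assoc (f d) (f* u′) _ ⟩
      f d ++ f* u′ ++ l0 ∷ σ′  ≡⟨ cong (f d ++_) t′≡ ⟩
      f d ++ l0 ∷ t′           ∎)
  where open ≡-Reasoning
... | refl , refl = map₁ (cong (c ∷_)) (f*-0-cancel u u′ zσ zσ′ (trans t≡ (sym t′≡)))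

⟨⟩-injective : ∀ {ρ u σ ρ′ u′ σ′} → ZeroFree ρ → ZeroFree σ → ZeroFree ρ′ → ZeroFree σ′ →
               ⟨ ρ ∣ u ∣ σ ⟩ ≡ ⟨ ρ′ ∣ u′ ∣ σ′ ⟩ → ρ ≡ ρ′ × u ≡ u′ × σ ≡ σ′
⟨⟩-injective {ρ} {u} {σ} {ρ′} {u′} {σ′} zρ zσ zρ′ zσ′ eq with f*-++-0 u σ | f*-++-0 u′ σ′
... | t , t≡ | t′ , t′≡ with zero-free-prefix-unique zρ zρ′ (trans (cong (ρ ++_) (sym t≡)) (trans eq (cong (ρ′ ++_) t′≡)))
... | refl , _ with f*-0-cancel u u′ zσ zσ′ (++-cancelˡ ρ _ _ eq)
... | refl , refl = refl , refl , refl

extension-⟨⟩⁻ : ∀ {ρ u σ a b} → Gap ρ → Gap σ → Extension ⟨ ρ ∣ u ∣ σ ⟩ a b →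
                ∃₂ λ c d → Extension u c d × Ends ρ c a × Ends σ d b
extension-⟨⟩⁻ {ρ} {u} {σ} {a} {b} gρ gσ e =
  recover (desubstitute (Gap⇒ZeroFree gρ) (subst (λ v → Extension (ρ ++ v) a b) (proj₂ (f*-++-0 u σ)) e))
  where
  recover : Desubstitution (ρ ++ l0 ∷ proj₁ (f*-++-0 u σ)) a b → ∃₂ λ c d → Extension u c d × Ends ρ c a × Ends σ d b
  recover (desubstitution ρ′ u′ σ′ c d w≡ e′ l r) = same-decomposition injective
    where
    injective : ρ ≡ ρ′ × u ≡ u′ × σ ≡ σ′
    injective = ⟨⟩-injective (Gap⇒ZeroFree gρ) (Gap⇒ZeroFree gσ) (Gap⇒ZeroFree (Ends⇒Gap l)) (Gap⇒ZeroFree (Ends⇒Gap r))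
                             (trans (cong (ρ ++_) (proj₂ (f*-++-0 u σ))) w≡)
    same-decomposition : ρ ≡ ρ′ × u ≡ u′ × σ ≡ σ′ → ∃₂ λ c d → Extension u c d × Ends ρ c a × Ends σ d b
    same-decomposition (refl , refl , refl) = c , d , e′ , l , r

reverse-f*-0 : ∀ u → l0 ∷ reverse (f* u) ≡ f* (reverse u) ++ [ l0 ]
reverse-f*-0 [] = refl
reverse-f*-0 (c ∷ u) = begin
  l0 ∷ reverse (f c ++ f* u)                   ≡⟨ cong (l0 ∷_) (reverse-++ (f c) (f* u)) ⟩
  (l0 ∷ reverse (f* u)) ++ reverse (f c)       ≡⟨ cong (_++ reverse (f c)) (reverse-f*-0 u) ⟩
  (f* (reverse u) ++ [ l0 ]) ++ reverse (f c)  ≡⟨ ++-assoc (f* (reverse u)) [ l0 ] (reverse (f c)) ⟩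
  f* (reverse u) ++ l0 ∷ reverse (f c)         ≡⟨ cong (f* (reverse u) ++_) (f-0-palindrome c) ⟩
  f* (reverse u) ++ f c ++ [ l0 ]              ≡⟨ sym (++-assoc (f* (reverse u)) (f c) [ l0 ]) ⟩
  (f* (reverse u) ++ f c) ++ [ l0 ]            ≡⟨ cong (λ v → (f* (reverse u) ++ v) ++ [ l0 ]) (sym (++-identityʳ (f c))) ⟩
  (f* (reverse u) ++ f* [ c ]) ++ [ l0 ]       ≡⟨ cong (_++ [ l0 ]) (sym (f*-++ (reverse u) [ c ])) ⟩
  f* (reverse u ++ [ c ]) ++ [ l0 ]            ≡⟨ cong (λ v → f* v ++ [ l0 ]) (sym (unfold-reverse c u)) ⟩
  f* (reverse (c ∷ u)) ++ [ l0 ]               ∎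
  where
  open ≡-Reasoning
  f-0-palindrome : ∀ c → l0 ∷ reverse (f c) ≡ f c ++ [ l0 ]
  f-0-palindrome l0 = refl
  f-0-palindrome l1 = refl
  f-0-palindrome l2 = refl

reverse-⟨⟩ : ∀ {ρ σ} u → Palindrome ρ → Palindrome σ → reverse ⟨ ρ ∣ u ∣ σ ⟩ ≡ ⟨ σ ∣ reverse u ∣ ρ ⟩
reverse-⟨⟩ {ρ} {σ} u pρ pσ = begin
  reverse (ρ ++ f* u ++ l0 ∷ σ)                          ≡⟨ reverse-++ ρ _ ⟩
  reverse (f* u ++ l0 ∷ σ) ++ reverse ρ                  ≡⟨ cong (_++ reverse ρ) (reverse-++ (f* u) (l0 ∷ σ)) ⟩
  (reverse (l0 ∷ σ) ++ reverse (f* u)) ++ reverse ρ      ≡⟨ cong (λ v → (v ++ reverse (f* u)) ++ reverse ρ) (unfold-reverse l0 σ) ⟩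
  ((reverse σ ++ [ l0 ]) ++ reverse (f* u)) ++ reverse ρ ≡⟨ cong₂ (λ v v′ → ((v ++ [ l0 ]) ++ reverse (f* u)) ++ v′) pσ pρ ⟩
  ((σ ++ [ l0 ]) ++ reverse (f* u)) ++ ρ                 ≡⟨ reassoc₁ σ [ l0 ] (reverse (f* u)) ρ ⟩
  σ ++ (l0 ∷ reverse (f* u)) ++ ρ                        ≡⟨ cong (λ v → σ ++ v ++ ρ) (reverse-f*-0 u) ⟩
  σ ++ (f* (reverse u) ++ [ l0 ]) ++ ρ                   ≡⟨ reassoc₂ σ (f* (reverse u)) [ l0 ] ρ ⟩
  σ ++ f* (reverse u) ++ l0 ∷ ρ                          ∎
  where
  open ≡-Reasoning
  reassoc₁ : ∀ (σ z r ρ : Word) → ((σ ++ z) ++ r) ++ ρ ≡ σ ++ (z ++ r) ++ ρ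
  reassoc₁ σ z r ρ = solve (++-monoid Letter)
  reassoc₂ : ∀ (σ g z ρ : Word) → σ ++ (g ++ z) ++ ρ ≡ σ ++ g ++ z ++ ρ
  reassoc₂ σ g z ρ = solve (++-monoid Letter)

palindromic-⟨⟩ : ∀ {ρ u σ} → Gap ρ → Gap σ → Palindrome ⟨ ρ ∣ u ∣ σ ⟩ → ρ ≡ σ × Palindrome u
palindromic-⟨⟩ {ρ} {u} {σ} gρ gσ pal = sym (proj₁ injective) , proj₁ (proj₂ injective)
  where
  zρ = Gap⇒ZeroFree gρ
  zσ = Gap⇒ZeroFree gσ
  injective : σ ≡ ρ × reverse u ≡ u × ρ ≡ σ
  injective = ⟨⟩-injective zσ zρ zρ zσ (trans (sym (reverse-⟨⟩ u (Gap⇒Palindrome gρ) (Gap⇒Palindrome gσ))) pal)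

length-⟨⟩ : ∀ ρ u σ → length u < length ⟨ ρ ∣ u ∣ σ ⟩
length-⟨⟩ ρ u σ = begin-strict
  length u                          ≤⟨ m≤m+n (length u) (length u) ⟩
  length u + length u               ≤⟨ length-f* u ⟩
  length (f* u)                     ≤⟨ length-++-≤ˡ (f* u) ⟩
  length (f* u ++ σ)                <⟨ ≤-reflexive (sym (length-++-sucʳ (f* u) l0 σ)) ⟩
  length (f* u ++ l0 ∷ σ)           ≤⟨ length-++-≤ʳ (f* u ++ l0 ∷ σ) {ρ} ⟩
  length (ρ ++ f* u ++ l0 ∷ σ)      ∎
  where open ≤-Reasoning

palindrome-desubstitution : ∀ {r w₁} → ZeroFree r → Factor′ (r ++ l0 ∷ w₁) → Palindrome (r ++ l0 ∷ w₁) →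
                            ∃₂ λ ρ u → Gap ρ × r ++ l0 ∷ w₁ ≡ ⟨ ρ ∣ u ∣ ρ ⟩ × Factor′ u × Palindrome u
palindrome-desubstitution {r} {w₁} zr fw pw = symmetric (desubstitute zr (proj₂ (proj₂ (Factor′-bi-extension fw))))
  where
  symmetric : ∀ {a b} → Desubstitution (r ++ l0 ∷ w₁) a b →
              ∃₂ λ ρ u → Gap ρ × r ++ l0 ∷ w₁ ≡ ⟨ ρ ∣ u ∣ ρ ⟩ × Factor′ u × Palindrome u
  symmetric (desubstitution ρ u σ c d w≡ e l r′) =
    let (ρ≡σ , pu) = palindromic-⟨⟩ (Ends⇒Gap l) (Ends⇒Gap r′) (subst Palindrome w≡ pw)
    in ρ , u , Ends⇒Gap l , subst (λ σ → r ++ l0 ∷ w₁ ≡ ⟨ ρ ∣ u ∣ σ ⟩) (sym ρ≡σ) w≡ , Extension⇒Factor′ e , pu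

-- Extension types

-- The extension sets of palindromic factors: A is that of ε, B of 0, C of 2, D of 020,
-- E of 201020102, and Oₐ is {(a , a)}.  Mem T a b says (a , b) ∈ T.
data ExtType : Set where
  A B C D E O₀ O₁ O₂ : ExtType

data Mem : ExtType → Letter → Letter → Set where
  A01 : Mem A l0 l1
  A02 : Mem A l0 l2
  A10 : Mem A l1 l0
  A20 : Mem A l2 l0
  A22 : Mem A l2 l2
  B12 : Mem B l1 l2
  B21 : Mem B l2 l1
  B22 : Mem B l2 l2
  C00 : Mem C l0 l0
  C02 : Mem C l0 l2
  C20 : Mem C l2 l0
  D11 : Mem D l1 l1
  D12 : Mem D l1 l2
  D21 : Mem D l2 l1
  E02 : Mem E l0 l2
  E20 : Mem E l2 l0
  E22 : Mem E l2 l2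
  O00 : Mem O₀ l0 l0
  O11 : Mem O₁ l1 l1
  O22 : Mem O₂ l2 l2

diagonal : ∀ T → ∃ λ a → Mem T a a
diagonal A = l2 , A22
diagonal B = l2 , B22
diagonal C = l0 , C00
diagonal D = l1 , D11
diagonal E = l2 , E22
diagonal O₀ = l0 , O00
diagonal O₁ = l1 , O11
diagonal O₂ = l2 , O22

diagonal-unique : ∀ {T a b} → Mem T a a → Mem T b b → a ≡ b
diagonal-unique A22 A22 = refl
diagonal-unique B22 B22 = refl
diagonal-unique C00 C00 = refl
diagonal-unique D11 D11 = refl
diagonal-unique E22 E22 = refl
diagonal-unique O00 O00 = refl
diagonal-unique O11 O11 = refl
diagonal-unique O22 O22 = refl

-- The image of an extension set under Ends ρ × Ends ρ (nothing when it is empty).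
liftType : ∀ {ρ} → Gap ρ → ExtType → Maybe ExtType
liftType ε A = just B
liftType ε B = just O₂
liftType ε C = just D
liftType ε D = just O₂
liftType ε E = just B
liftType ε O₀ = just O₁
liftType ε O₁ = just O₂
liftType ε O₂ = just O₂
liftType ⟨1⟩ C = just O₀
liftType ⟨1⟩ O₀ = just O₀
liftType ⟨1⟩ _ = nothing
liftType ⟨2⟩ A = just O₀
liftType ⟨2⟩ B = just C
liftType ⟨2⟩ D = just E
liftType ⟨2⟩ E = just O₀
liftType ⟨2⟩ O₁ = just O₂
liftType ⟨2⟩ O₂ = just O₀
liftType ⟨2⟩ _ = nothing
liftType ⟨22⟩ D = just O₀
liftType ⟨22⟩ O₁ = just O₀
liftType ⟨22⟩ _ = nothing

liftType-sound : ∀ {ρ T c d a b} (g : Gap ρ) → Mem T c d → Ends ρ c a → Ends ρ d b →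
                 Any (λ T′ → Mem T′ a b) (liftType g T)
liftType-sound ε A01 0▹1 1▹2 = just B12
liftType-sound _ A01 0▹01 ()
liftType-sound ε A02 0▹1 2▹2 = just B12
liftType-sound _ A02 0▹01 ()
liftType-sound ε A10 1▹2 0▹1 = just B21
liftType-sound _ A10 1▹22 ()
liftType-sound _ A10 1▹022 ()
liftType-sound ε A20 2▹2 0▹1 = just B21
liftType-sound _ A20 2▹02 ()
liftType-sound ε A22 2▹2 2▹2 = just B22
liftType-sound ⟨2⟩ A22 2▹02 2▹02 = just O00
liftType-sound ε B12 1▹2 2▹2 = just O22
liftType-sound ⟨2⟩ B12 1▹22 2▹02 = just C20
liftType-sound _ B12 1▹022 ()
liftType-sound ε B21 2▹2 1▹2 = just O22
liftType-sound ⟨2⟩ B21 2▹02 1▹22 = just C02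
liftType-sound ε B22 2▹2 2▹2 = just O22
liftType-sound ⟨2⟩ B22 2▹02 2▹02 = just C00
liftType-sound ε C00 0▹1 0▹1 = just D11
liftType-sound ⟨1⟩ C00 0▹01 0▹01 = just O00
liftType-sound ε C02 0▹1 2▹2 = just D12
liftType-sound _ C02 0▹01 ()
liftType-sound ε C20 2▹2 0▹1 = just D21
liftType-sound _ C20 2▹02 ()
liftType-sound ε D11 1▹2 1▹2 = just O22
liftType-sound ⟨2⟩ D11 1▹22 1▹22 = just E22
liftType-sound ⟨22⟩ D11 1▹022 1▹022 = just O00
liftType-sound ε D12 1▹2 2▹2 = just O22
liftType-sound ⟨2⟩ D12 1▹22 2▹02 = just E20
liftType-sound _ D12 1▹022 ()
liftType-sound ε D21 2▹2 1▹2 = just O22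
liftType-sound ⟨2⟩ D21 2▹02 1▹22 = just E02
liftType-sound ε E02 0▹1 2▹2 = just B12
liftType-sound _ E02 0▹01 ()
liftType-sound ε E20 2▹2 0▹1 = just B21
liftType-sound _ E20 2▹02 ()
liftType-sound ε E22 2▹2 2▹2 = just B22
liftType-sound ⟨2⟩ E22 2▹02 2▹02 = just O00
liftType-sound ε O00 0▹1 0▹1 = just O11
liftType-sound ⟨1⟩ O00 0▹01 0▹01 = just O00
liftType-sound ε O11 1▹2 1▹2 = just O22
liftType-sound ⟨2⟩ O11 1▹22 1▹22 = just O22
liftType-sound ⟨22⟩ O11 1▹022 1▹022 = just O00
liftType-sound ε O22 2▹2 2▹2 = just O22
liftType-sound ⟨2⟩ O22 2▹02 2▹02 = just O00

liftType-complete : ∀ {ρ a b} (g : Gap ρ) T → Any (λ T′ → Mem T′ a b) (liftType g T) →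
                    ∃₂ λ c d → Mem T c d × Ends ρ c a × Ends ρ d b
liftType-complete ε A (just B12) = _ , _ , A01 , 0▹1 , 1▹2
liftType-complete ε A (just B21) = _ , _ , A10 , 1▹2 , 0▹1
liftType-complete ε A (just B22) = _ , _ , A22 , 2▹2 , 2▹2
liftType-complete ε B (just O22) = _ , _ , B12 , 1▹2 , 2▹2
liftType-complete ε C (just D11) = _ , _ , C00 , 0▹1 , 0▹1
liftType-complete ε C (just D12) = _ , _ , C02 , 0▹1 , 2▹2
liftType-complete ε C (just D21) = _ , _ , C20 , 2▹2 , 0▹1
liftType-complete ε D (just O22) = _ , _ , D11 , 1▹2 , 1▹2
liftType-complete ε E (just B12) = _ , _ , E02 , 0▹1 , 2▹2
liftType-complete ε E (just B21) = _ , _ , E20 , 2▹2 , 0▹1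
liftType-complete ε E (just B22) = _ , _ , E22 , 2▹2 , 2▹2
liftType-complete ε O₀ (just O11) = _ , _ , O00 , 0▹1 , 0▹1
liftType-complete ε O₁ (just O22) = _ , _ , O11 , 1▹2 , 1▹2
liftType-complete ε O₂ (just O22) = _ , _ , O22 , 2▹2 , 2▹2
liftType-complete ⟨1⟩ A ()
liftType-complete ⟨1⟩ B ()
liftType-complete ⟨1⟩ C (just O00) = _ , _ , C00 , 0▹01 , 0▹01
liftType-complete ⟨1⟩ D ()
liftType-complete ⟨1⟩ E ()
liftType-complete ⟨1⟩ O₀ (just O00) = _ , _ , O00 , 0▹01 , 0▹01
liftType-complete ⟨1⟩ O₁ ()
liftType-complete ⟨1⟩ O₂ ()
liftType-complete ⟨2⟩ A (just O00) = _ , _ , A22 , 2▹02 , 2▹02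
liftType-complete ⟨2⟩ B (just C00) = _ , _ , B22 , 2▹02 , 2▹02
liftType-complete ⟨2⟩ B (just C02) = _ , _ , B21 , 2▹02 , 1▹22
liftType-complete ⟨2⟩ B (just C20) = _ , _ , B12 , 1▹22 , 2▹02
liftType-complete ⟨2⟩ C ()
liftType-complete ⟨2⟩ D (just E02) = _ , _ , D21 , 2▹02 , 1▹22
liftType-complete ⟨2⟩ D (just E20) = _ , _ , D12 , 1▹22 , 2▹02
liftType-complete ⟨2⟩ D (just E22) = _ , _ , D11 , 1▹22 , 1▹22
liftType-complete ⟨2⟩ E (just O00) = _ , _ , E22 , 2▹02 , 2▹02
liftType-complete ⟨2⟩ O₀ ()
liftType-complete ⟨2⟩ O₁ (just O22) = _ , _ , O11 , 1▹22 , 1▹22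
liftType-complete ⟨2⟩ O₂ (just O00) = _ , _ , O22 , 2▹02 , 2▹02
liftType-complete ⟨22⟩ A ()
liftType-complete ⟨22⟩ B ()
liftType-complete ⟨22⟩ C ()
liftType-complete ⟨22⟩ D (just O00) = _ , _ , D11 , 1▹022 , 1▹022
liftType-complete ⟨22⟩ E ()
liftType-complete ⟨22⟩ O₀ ()
liftType-complete ⟨22⟩ O₁ (just O00) = _ , _ , O11 , 1▹022 , 1▹022
liftType-complete ⟨22⟩ O₂ ()

record _HasType_ (w : Word) (T : ExtType) : Set where
  field
    sound    : ∀ {a b} → Extension w a b → Mem T a b
    complete : ∀ {a b} → Mem T a b → Extension w a b
open _HasType_

-- The extensions present are found in fIter 3 = 01022010202; the others contain 00 or a
-- zero-free word that is not a gap.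
gap-type : ∀ {ρ} → Gap ρ → ∃ λ T → ρ HasType T
gap-type ε = A , record { sound = sound′ ; complete = complete′ }
  where
  sound′ : ∀ {a b} → Extension [] a b → Mem A a b
  sound′ {l0} {l0} e = ⊥-elim (00-not-factor e)
  sound′ {l0} {l1} e = A01
  sound′ {l0} {l2} e = A02
  sound′ {l1} {l0} e = A10
  sound′ {l2} {l0} e = A20
  sound′ {l2} {l2} e = A22
  sound′ {l1} {l1} e with zero-free-factor⇒Gap e (1∷ 1∷ [])
  ... | ()
  sound′ {l1} {l2} e with zero-free-factor⇒Gap e (1∷ 2∷ [])
  ... | ()
  sound′ {l2} {l1} e with zero-free-factor⇒Gap e (2∷ 1∷ [])
  ... | ()
  complete′ : ∀ {a b} → Mem A a b → Extension [] a b
  complete′ A01 = 3 , [] , _ , refl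
  complete′ A02 = 3 , l0 ∷ l1 ∷ [] , _ , refl
  complete′ A10 = 3 , l0 ∷ [] , _ , refl
  complete′ A20 = 3 , l0 ∷ l1 ∷ l0 ∷ l2 ∷ [] , _ , refl
  complete′ A22 = 3 , l0 ∷ l1 ∷ l0 ∷ [] , _ , refl
gap-type ⟨1⟩ = O₀ , record { sound = sound′ ; complete = λ { O00 → 3 , [] , _ , refl } }
  where
  sound′ : ∀ {a b} → Extension (l1 ∷ []) a b → Mem O₀ a b
  sound′ {l0} {l0} e = O00
  sound′ {l0} {l1} e with zero-free-factor⇒Gap (Factor′-suffix [ l0 ] e) (1∷ 1∷ [])
  ... | ()
  sound′ {l0} {l2} e with zero-free-factor⇒Gap (Factor′-suffix [ l0 ] e) (1∷ 2∷ [])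
  ... | ()
  sound′ {l1} e with zero-free-factor⇒Gap (Factor′-prefix (l1 ∷ l1 ∷ []) e) (1∷ 1∷ [])
  ... | ()
  sound′ {l2} e with zero-free-factor⇒Gap (Factor′-prefix (l2 ∷ l1 ∷ []) e) (2∷ 1∷ [])
  ... | ()
gap-type ⟨2⟩ = C , record { sound = sound′ ; complete = complete′ }
  where
  sound′ : ∀ {a b} → Extension (l2 ∷ []) a b → Mem C a b
  sound′ {l0} {l0} e = C00
  sound′ {l0} {l2} e = C02
  sound′ {l2} {l0} e = C20
  sound′ {l0} {l1} e with zero-free-factor⇒Gap (Factor′-suffix [ l0 ] e) (2∷ 1∷ [])
  ... | ()
  sound′ {l2} {l1} e with zero-free-factor⇒Gap (Factor′-suffix [ l2 ] e) (2∷ 1∷ [])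
  ... | ()
  sound′ {l2} {l2} e with zero-free-factor⇒Gap e (2∷ 2∷ 2∷ [])
  ... | ()
  sound′ {l1} e with zero-free-factor⇒Gap (Factor′-prefix (l1 ∷ l2 ∷ []) e) (1∷ 2∷ [])
  ... | ()
  complete′ : ∀ {a b} → Mem C a b → Extension (l2 ∷ []) a b
  complete′ C00 = 3 , l0 ∷ l1 ∷ l0 ∷ l2 ∷ l2 ∷ l0 ∷ l1 ∷ [] , _ , refl
  complete′ C02 = 3 , l0 ∷ l1 ∷ [] , _ , refl
  complete′ C20 = 3 , l0 ∷ l1 ∷ l0 ∷ [] , _ , refl
gap-type ⟨22⟩ = O₀ , record { sound = sound′ ; complete = λ { O00 → 3 , l0 ∷ l1 ∷ [] , _ , refl } }
  where
  sound′ : ∀ {a b} → Extension (l2 ∷ l2 ∷ []) a b → Mem O₀ a b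
  sound′ {l0} {l0} e = O00
  sound′ {l0} {l1} e with zero-free-factor⇒Gap (Factor′-suffix [ l0 ] e) (2∷ 2∷ 1∷ [])
  ... | ()
  sound′ {l0} {l2} e with zero-free-factor⇒Gap (Factor′-suffix [ l0 ] e) (2∷ 2∷ 2∷ [])
  ... | ()
  sound′ {l1} e with zero-free-factor⇒Gap (Factor′-prefix (l1 ∷ l2 ∷ l2 ∷ []) e) (1∷ 2∷ 2∷ [])
  ... | ()
  sound′ {l2} e with zero-free-factor⇒Gap (Factor′-prefix (l2 ∷ l2 ∷ l2 ∷ []) e) (2∷ 2∷ 2∷ [])
  ... | ()

liftType-defined : ∀ {ρ u T} (g : Gap ρ) → u HasType T → Factor′ ⟨ ρ ∣ u ∣ ρ ⟩ → ∃ λ T′ → liftType g T ≡ just T′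
liftType-defined g uT fw =
  let (_ , _ , e) = Factor′-bi-extension fw
      (_ , _ , e′ , l , r) = extension-⟨⟩⁻ g g e
  in Any⇒just (liftType-sound g (sound uT e′) l r)

lift-type : ∀ {ρ u T T′} (g : Gap ρ) → liftType g T ≡ just T′ → u HasType T → ⟨ ρ ∣ u ∣ ρ ⟩ HasType T′
lift-type g lift≡ uT .sound e =
  let (_ , _ , e′ , l , r) = extension-⟨⟩⁻ g g e
  in drop-just (subst (Any (λ T″ → Mem T″ _ _)) lift≡ (liftType-sound g (sound uT e′) l r))
lift-type {T = T} g lift≡ uT .complete m =
  let (_ , _ , m′ , l , r) = liftType-complete g T (subst (Any (λ T″ → Mem T″ _ _)) (sym lift≡) (just m))
  in lift-extension (complete uT m′) l r

palindromic-type : ∀ w → Acc _<_ (length w) → Factor′ w → Palindrome w → ∃ λ T → w HasType T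
palindromic-type w (acc smaller) fw pw with first-zero w
... | inj₁ zw = gap-type (zero-free-factor⇒Gap fw zw)
... | inj₂ (r , w₁ , zr , refl) =
  let (ρ , u , g , w≡ , fu , pu) = palindrome-desubstitution zr fw pw
      (T , uT) = palindromic-type u (smaller (subst (length u <_) (sym (cong length w≡)) (length-⟨⟩ ρ u ρ))) fu pu
      (T′ , lift≡) = liftType-defined g uT (subst Factor′ w≡ fw)
  in T′ , subst (_HasType T′) (sym w≡) (lift-type g lift≡ uT)

proposition26 : (w : List Letter) → Factor w → Palindrome w →
    ∃! _≡_ (λ (a : Letter) → Factor (a ∷ w ++ a ∷ []))
proposition26 w fw pw with palindromic-type w (<-wellFounded (length w)) (Factor⇒Factor′ fw) pw
... | T , wT with diagonal T
... | a , aa = a , Factor′⇒Factor (complete wT aa) , λ fb → diagonal-unique aa (sound wT (Factor⇒Factor′ fb))
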